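{- The left contraction rule $(ic_l)$: from $\mathcal{G}/\!/\Gamma,A,A\vdash\Delta/\!/\mathcal{H}$ infer $\mathcal{G}/\!/\Gamma,A\vdash\Delta/\!/\mathcal{H}$, is admissible in $\mathsf{LNIF}$: if the premise is derivable in $\mathsf{LNIF}$, so is the conclusion.
   Context: Formulae are first-order over $\bot,\land,\lor,\supset,\forall,\exists$; in sequents bound variables $x,y,\dots$ are distinct from parameters $a,b,\dots$, which occupy all free positions; $A[a/x]$ replaces free occurrences of $x$ by $a$; $p(\vec a)$ is an atomic formula with parameters $\vec a$. A linear nested sequent is $\Gamma_1\vdash\Delta_1 /\!/ \cdots /\!/ \Gamma_n\vdash\Delta_n$ ($n\ge1$), each $\Gamma_i,\Delta_i$ a finite, possibly empty, multiset of formulae (a component). In rule schemas, $\mathcal{G},\mathcal{H},\mathcal{F}$ denote possibly empty sequences of components. $\mathsf{LNIF}$ has the rules (from premise(s) infer conclusion): Initial: $(id_1)$ $\mathcal{G}/\!/\Gamma,p(\vec a)\vdash p(\vec a),\Delta/\!/\mathcal{H}$; $(id_2)$ $\mathcal{G}/\!/\Gamma_1,p(\vec a)\vdash\Delta_1/\!/\mathcal{H}/\!/\Gamma_2\vdash p(\vec a),\Delta_2/\!/\mathcal{F}$; $(\bot_l)$ $\mathcal{G}/\!/\Gamma,\bot\vdash\Delta/\!/\mathcal{H}$. $(\land_l)$: from $\mathcal{G}/\!/\Gamma,A,B\vdash\Delta/\!/\mathcal{H}$ infer $\mathcal{G}/\!/\Gamma,A\land B\vdash\Delta/\!/\mathcal{H}$.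 $(\lor_r)$: from $\mathcal{G}/\!/\Gamma\vdash\Delta,A,B/\!/\mathcal{H}$ infer $\mathcal{G}/\!/\Gamma\vdash\Delta,A\lor B/\!/\mathcal{H}$. $(\land_r)$: from $\mathcal{G}/\!/\Gamma\vdash\Delta,A/\!/\mathcal{H}$ and $\mathcal{G}/\!/\Gamma\vdash\Delta,B/\!/\mathcal{H}$ infer $\mathcal{G}/\!/\Gamma\vdash\Delta,A\land B/\!/\mathcal{H}$. $(\lor_l)$: from $\mathcal{G}/\!/\Gamma,A\vdash\Delta/\!/\mathcal{H}$ and $\mathcal{G}/\!/\Gamma,B\vdash\Delta/\!/\mathcal{H}$ infer $\mathcal{G}/\!/\Gamma,A\lor B\vdash\Delta/\!/\mathcal{H}$. $(\supset_{r1})$: from $\mathcal{G}/\!/\Gamma\vdash\Delta/\!/A\vdash B$ infer $\mathcal{G}/\!/\Gamma\vdash\Delta,A\supset B$. $(\supset_l)$: from $\mathcal{G}/\!/\Gamma,B\vdash\Delta/\!/\mathcal{H}$ and $\mathcal{G}/\!/\Gamma,A\supset B\vdash A,\Delta/\!/\mathcal{H}$ infer $\mathcal{G}/\!/\Gamma,A\supset B\vdash\Delta/\!/\mathcal{H}$. $(lift)$: from $\mathcal{G}/\!/\Gamma_1,A\vdash\Delta_1/\!/\Gamma_2,A\vdash\Delta_2/\!/\mathcal{H}$ infer $\mathcal{G}/\!/\Gamma_1,A\vdash\Delta_1/\!/\Gamma_2\vdash\Delta_2/\!/\mathcal{H}$. $(\forall_l)$: from $\mathcal{G}/\!/\Gamma,A[a/x],\forall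 xA\vdash\Delta/\!/\mathcal{H}$ infer $\mathcal{G}/\!/\Gamma,\forall xA\vdash\Delta/\!/\mathcal{H}$ ($a$ any parameter). $(\forall_{r1})$: from $\mathcal{G}/\!/\Gamma\vdash\Delta/\!/\ \vdash A[a/x]$ infer $\mathcal{G}/\!/\Gamma\vdash\Delta,\forall xA$. $(\exists_l)$: from $\mathcal{G}/\!/\Gamma,A[a/x]\vdash\Delta/\!/\mathcal{H}$ infer $\mathcal{G}/\!/\Gamma,\exists xA\vdash\Delta/\!/\mathcal{H}$. $(\exists_r)$: from $\mathcal{G}/\!/\Gamma\vdash A[a/x],\exists xA,\Delta/\!/\mathcal{H}$ infer $\mathcal{G}/\!/\Gamma\vdash\exists xA,\Delta/\!/\mathcal{H}$ ($a$ any parameter). $(\supset_{r2})$: from $\mathcal{G}/\!/\Gamma_1\vdash\Delta_1/\!/A\vdash B/\!/\Gamma_2\vdash\Delta_2/\!/\mathcal{H}$ and $\mathcal{G}/\!/\Gamma_1\vdash\Delta_1/\!/\Gamma_2\vdash\Delta_2,A\supset B/\!/\mathcal{H}$ infer $\mathcal{G}/\!/\Gamma_1\vdash\Delta_1,A\supset B/\!/\Gamma_2\vdash\Delta_2/\!/\mathcal{H}$. $(\forall_{r2})$: from $\mathcal{G}/\!/\Gamma_1\vdash\Delta_1/\!/\ \vdash A[a/x]/\!/\Gamma_2\vdash\Delta_2/\!/\mathcal{H}$ and $\mathcal{G}/\!/\Gamma_1\vdash\Delta_1/\!/\Gamma_2\vdash\Delta_2,\forall xA/\!/\mathcal{H}$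 infer $\mathcal{G}/\!/\Gamma_1\vdash\Delta_1,\forall xA/\!/\Gamma_2\vdash\Delta_2/\!/\mathcal{H}$. In $(\forall_{r1}),(\exists_l),(\forall_{r2})$, $a$ is an eigenvariable (does not occur in the conclusion). -}

module Defs where

open import Data.Nat using (ℕ; _≟_)
open import Data.List using (List; []; _∷_; [_]; _++_)
open import Data.List.Membership.Propositional using (_∈_)
open import Data.List.Relation.Binary.Permutation.Propositional using (_↭_)
open import Data.List.Relation.Unary.All using (All)
open import Data.List.Relation.Unary.Any using (Any)
open import Data.Empty using (⊥)
open import Data.Unit using (⊤)
open import Data.Product using (_×_)
open import Data.Sum using (_⊎_)
open import Relation.Nullary using (¬_; yes; no)
open import Relation.Binary.PropositionalEquality using (_≡_)

-- Bound variables and parameters are two disjoint sorts (both named by ℕ).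
Var : Set
Var = ℕ

Par : Set
Par = ℕ

data Term : Set where
  var : Var → Term
  par : Par → Term

data Formula : Set where
  atom : ℕ → List Term → Formula
  ⊥'   : Formula
  _∧'_ : Formula → Formula → Formula
  _∨'_ : Formula → Formula → Formula
  _⊃_  : Formula → Formula → Formula
  ∀'   : Var → Formula → Formula
  ∃'   : Var → Formula → Formula

substT : Par → Var → Term → Term
substT a x (var y) with x ≟ y
... | yes _ = par a
... | no  _ = var y
substT a x (par b) = par b

substTs : Par → Var → List Term → List Term
substTs a x []       = []
substTs a x (t ∷ ts) = substT a x t ∷ substTs a x ts

_[_/_] : Formula → Par → Var → Formula
atom p ts [ a / x ] = atom p (substTs a x ts)
⊥'        [ a / x ] = ⊥'
(A ∧' B)  [ a / x ] = (A [ a / x ]) ∧' (B [ a / x ])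
(A ∨' B)  [ a / x ] = (A [ a / x ]) ∨' (B [ a / x ])
(A ⊃ B)   [ a / x ] = (A [ a / x ]) ⊃ (B [ a / x ])
∀' y A    [ a / x ] with x ≟ y
... | yes _ = ∀' y A
... | no  _ = ∀' y (A [ a / x ])
∃' y A    [ a / x ] with x ≟ y
... | yes _ = ∃' y A
... | no  _ = ∃' y (A [ a / x ])

data ParInT (a : Par) : Term → Set where
  here : ParInT a (par a)

data ParIn (a : Par) : Formula → Set where
  atm : ∀ {p ts} → Any (ParInT a) ts → ParIn a (atom p ts)
  ∧ˡ  : ∀ {A B} → ParIn a A → ParIn a (A ∧' B)
  ∧ʳ  : ∀ {A B} → ParIn a B → ParIn a (A ∧' B)
  ∨ˡ  : ∀ {A B} → ParIn a A → ParIn a (A ∨' B)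
  ∨ʳ  : ∀ {A B} → ParIn a B → ParIn a (A ∨' B)
  ⊃ˡ  : ∀ {A B} → ParIn a A → ParIn a (A ⊃ B)
  ⊃ʳ  : ∀ {A B} → ParIn a B → ParIn a (A ⊃ B)
  ∀ᵇ  : ∀ {y A} → ParIn a A → ParIn a (∀' y A)
  ∃ᵇ  : ∀ {y A} → ParIn a A → ParIn a (∃' y A)

-- Free occurrence of a bound variable (used to express that formulas in
-- sequents have no free bound variables: parameters occupy all free positions).
data VarFreeIn (x : Var) : Formula → Set where
  atm : ∀ {p ts} → var x ∈ ts → VarFreeIn x (atom p ts)
  ∧ˡ  : ∀ {A B} → VarFreeIn x A → VarFreeIn x (A ∧' B)
  ∧ʳ  : ∀ {A B} → VarFreeIn x B → VarFreeIn x (A ∧' B)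
  ∨ˡ  : ∀ {A B} → VarFreeIn x A → VarFreeIn x (A ∨' B)
  ∨ʳ  : ∀ {A B} → VarFreeIn x B → VarFreeIn x (A ∨' B)
  ⊃ˡ  : ∀ {A B} → VarFreeIn x A → VarFreeIn x (A ⊃ B)
  ⊃ʳ  : ∀ {A B} → VarFreeIn x B → VarFreeIn x (A ⊃ B)
  ∀ᵇ  : ∀ {y A} → ¬ (x ≡ y) → VarFreeIn x A → VarFreeIn x (∀' y A)
  ∃ᵇ  : ∀ {y A} → ¬ (x ≡ y) → VarFreeIn x A → VarFreeIn x (∃' y A)

ClosedF : Formula → Set
ClosedF A = ∀ x → ¬ VarFreeIn x A

-- Components Γ ⊢ Δ; multisets are represented by lists, and every rule
-- matches its conclusion only up to permutation (_↭_) / membership (_∈_),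
-- so derivability is a property of the underlying multisets.
record Component : Set where
  constructor _⊢_
  field
    ant : List Formula
    suc : List Formula
open Component public

infix 4 _⊢_

-- A linear nested sequent: a (nonempty, enforced by the rules) list of components.
LNS : Set
LNS = List Component

ClosedC : Component → Set
ClosedC (Γ ⊢ Δ) = All ClosedF Γ × All ClosedF Δ

ClosedS : LNS → Set
ClosedS = All ClosedC

ParInC : Par → Component → Set
ParInC a (Γ ⊢ Δ) = Any (ParIn a) Γ ⊎ Any (ParIn a) Δ

Fresh : Par → LNS → Set
Fresh a S = ¬ Any (ParInC a) S

data LNIF : LNS → Set where
  id₁ : ∀ G H Γ Δ p ts →
        atom p ts ∈ Γ → atom p ts ∈ Δ →
        LNIF (G ++ [ Γ ⊢ Δ ] ++ H)
  id₂ : ∀ G H F Γ₁ Δ₁ Γ₂ Δ₂ p ts →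
        atom p ts ∈ Γ₁ → atom p ts ∈ Δ₂ →
        LNIF (G ++ [ Γ₁ ⊢ Δ₁ ] ++ H ++ [ Γ₂ ⊢ Δ₂ ] ++ F)
  ⊥ₗ  : ∀ G H Γ Δ → ⊥' ∈ Γ → LNIF (G ++ [ Γ ⊢ Δ ] ++ H)
  ∧ₗ  : ∀ G H Γ Γ₀ Δ A B → Γ ↭ (A ∧' B) ∷ Γ₀ →
        LNIF (G ++ [ A ∷ B ∷ Γ₀ ⊢ Δ ] ++ H) →
        LNIF (G ++ [ Γ ⊢ Δ ] ++ H)
  ∨ᵣ  : ∀ G H Γ Δ Δ₀ A B → Δ ↭ (A ∨' B) ∷ Δ₀ →
        LNIF (G ++ [ Γ ⊢ A ∷ B ∷ Δ₀ ] ++ H) →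
        LNIF (G ++ [ Γ ⊢ Δ ] ++ H)
  ∧ᵣ  : ∀ G H Γ Δ Δ₀ A B → Δ ↭ (A ∧' B) ∷ Δ₀ →
        LNIF (G ++ [ Γ ⊢ A ∷ Δ₀ ] ++ H) →
        LNIF (G ++ [ Γ ⊢ B ∷ Δ₀ ] ++ H) →
        LNIF (G ++ [ Γ ⊢ Δ ] ++ H)
  ∨ₗ  : ∀ G H Γ Γ₀ Δ A B → Γ ↭ (A ∨' B) ∷ Γ₀ →
        LNIF (G ++ [ A ∷ Γ₀ ⊢ Δ ] ++ H) →
        LNIF (G ++ [ B ∷ Γ₀ ⊢ Δ ] ++ H) →
        LNIF (G ++ [ Γ ⊢ Δ ] ++ H)
  ⊃ᵣ₁ : ∀ G Γ Δ Δ₀ A B → Δ ↭ (A ⊃ B) ∷ Δ₀ →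
        LNIF (G ++ [ Γ ⊢ Δ₀ ] ++ [ [ A ] ⊢ [ B ] ]) →
        LNIF (G ++ [ Γ ⊢ Δ ])
  ⊃ₗ  : ∀ G H Γ Γ₀ Δ A B → Γ ↭ (A ⊃ B) ∷ Γ₀ →
        LNIF (G ++ [ B ∷ Γ₀ ⊢ Δ ] ++ H) →
        LNIF (G ++ [ Γ ⊢ A ∷ Δ ] ++ H) →
        LNIF (G ++ [ Γ ⊢ Δ ] ++ H)
  lift : ∀ G H Γ₁ Δ₁ Γ₂ Δ₂ A → A ∈ Γ₁ →
        LNIF (G ++ [ Γ₁ ⊢ Δ₁ ] ++ [ A ∷ Γ₂ ⊢ Δ₂ ] ++ H) →
        LNIF (G ++ [ Γ₁ ⊢ Δ₁ ] ++ [ Γ₂ ⊢ Δ₂ ] ++ H)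
  ∀ₗ  : ∀ G H Γ Δ x A (a : Par) → ∀' x A ∈ Γ →
        LNIF (G ++ [ (A [ a / x ]) ∷ Γ ⊢ Δ ] ++ H) →
        LNIF (G ++ [ Γ ⊢ Δ ] ++ H)
  ∀ᵣ₁ : ∀ G Γ Δ Δ₀ x A (a : Par) → Δ ↭ ∀' x A ∷ Δ₀ →
        Fresh a (G ++ [ Γ ⊢ Δ ]) →
        LNIF (G ++ [ Γ ⊢ Δ₀ ] ++ [ [] ⊢ [ A [ a / x ] ] ]) →
        LNIF (G ++ [ Γ ⊢ Δ ])
  ∃ₗ  : ∀ G H Γ Γ₀ Δ x A (a : Par) → Γ ↭ ∃' x A ∷ Γ₀ →
        Fresh a (G ++ [ Γ ⊢ Δ ] ++ H) →
        LNIF (G ++ [ (A [ a / x ]) ∷ Γ₀ ⊢ Δ ] ++ H) →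
        LNIF (G ++ [ Γ ⊢ Δ ] ++ H)
  ∃ᵣ  : ∀ G H Γ Δ x A (a : Par) → ∃' x A ∈ Δ →
        LNIF (G ++ [ Γ ⊢ (A [ a / x ]) ∷ Δ ] ++ H) →
        LNIF (G ++ [ Γ ⊢ Δ ] ++ H)
  ⊃ᵣ₂ : ∀ G H Γ₁ Δ₁ Δ₁₀ Γ₂ Δ₂ A B → Δ₁ ↭ (A ⊃ B) ∷ Δ₁₀ →
        LNIF (G ++ [ Γ₁ ⊢ Δ₁₀ ] ++ [ [ A ] ⊢ [ B ] ] ++ [ Γ₂ ⊢ Δ₂ ] ++ H) →
        LNIF (G ++ [ Γ₁ ⊢ Δ₁₀ ] ++ [ Γ₂ ⊢ (A ⊃ B) ∷ Δ₂ ] ++ H) →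
        LNIF (G ++ [ Γ₁ ⊢ Δ₁ ] ++ [ Γ₂ ⊢ Δ₂ ] ++ H)
  ∀ᵣ₂ : ∀ G H Γ₁ Δ₁ Δ₁₀ Γ₂ Δ₂ x A (a : Par) → Δ₁ ↭ ∀' x A ∷ Δ₁₀ →
        Fresh a (G ++ [ Γ₁ ⊢ Δ₁ ] ++ [ Γ₂ ⊢ Δ₂ ] ++ H) →
        LNIF (G ++ [ Γ₁ ⊢ Δ₁₀ ] ++ [ [] ⊢ [ A [ a / x ] ] ] ++ [ Γ₂ ⊢ Δ₂ ] ++ H) →
        LNIF (G ++ [ Γ₁ ⊢ Δ₁₀ ] ++ [ Γ₂ ⊢ ∀' x A ∷ Δ₂ ] ++ H) →
        LNIF (G ++ [ Γ₁ ⊢ Δ₁ ] ++ [ Γ₂ ⊢ Δ₂ ] ++ H)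

{-# OPTIONS --safe #-}
-- Contraction is proved for all formulas at once, by induction on a bound b on their size and,
-- inside, on the derivation.  `Contracted b` deletes from each component copies of formulas of size
-- below b that still occur there, so that every rule instance is rebuilt from its contracted premises.
-- The only real case is a deleted copy that is principal in ∧ₗ, ∨ₗ, ⊃ₗ or ∃ₗ: apply the rule to the
-- surviving copy instead; its premise still holds that copy beside the new subformulas, so inverting
-- the rule there and contracting the smaller subformulas by induction closes the case.  The rules for
-- atoms, ⊥ and ∀, lift and the second premise of ⊃ₗ keep their principal formula.  Inversion relies on
-- height-preserving renaming: an ∃ₗ on an inverted copy of ∃xA is replaced by its own premise, with
-- the eigenvariable renamed to the instance being inverted to.

module Submission where

open import Defs hiding (suc)
open import Data.List using (List; []; _∷_; [_]; _++_; map; replicate; concat)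
open import Data.List.Properties using (++-assoc; map-cong; map-cong-local; map-id)
open import Data.List.Relation.Unary.All as All using (All; []; _∷_)
open import Data.List.Relation.Binary.Pointwise as Pointwise using (Pointwise; []; _∷_)
open import Data.List.Relation.Unary.All.Properties using (¬Any⇒All¬)
open import Data.List.Relation.Unary.Any using (Any; here; there)
open import Data.List.Relation.Unary.Any.Properties using (++⁺ˡ; ++⁺ʳ; ++⁻)
open import Data.List.Membership.Propositional using (_∈_)
open import Data.List.Membership.Propositional.Properties using (∈-map⁺; ∈-∃++)
open import Data.Nat using (ℕ; suc; _+_; _⊔_; _≤_; _<_; s≤s; _≟_)
open import Data.Nat.Properties using (m≤m⊔n; m≤n⊔m; m≤m+n; m≤n+m; ≤-refl; ≤-reflexive; ≤-trans; 1+n≰n)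
open import Data.List.Relation.Binary.Permutation.Propositional using (_↭_; ↭-refl; ↭-sym; ↭-trans; ↭-prep; ↭-reflexive)
open import Data.List.Relation.Binary.Permutation.Propositional.Properties
  using (Any-resp-↭; All-resp-↭; map⁺; shift; shifts; drop-∷) renaming (++⁺ˡ to ↭-++⁺ˡ; ++⁺ʳ to ↭-++⁺ʳ)
open import Data.List.Relation.Binary.Subset.Propositional using (_⊆_)
open import Data.Empty using (⊥-elim)
open import Data.Nat.Induction using (<-rec)
open import Data.Product using (∃; _×_; _,_; proj₂)
open import Data.Sum using (_⊎_; inj₁; inj₂; [_,_]′)
open import Function using (id; _∘_)
open import Relation.Nullary using (¬_; yes; no)
open import Relation.Binary.PropositionalEquality using (_≡_; refl; sym; trans; cong; cong₂; module ≡-Reasoning)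

∈⇒↭ : ∀ {A : Set} {x : A} {xs} → x ∈ xs → ∃ λ ys → xs ↭ x ∷ ys
∈⇒↭ {x = x} x∈xs with ∈-∃++ x∈xs
... | ys , zs , refl = ys ++ zs , shift x ys zs

∈-replicate⁻ : ∀ {A : Set} {x y : A} j → y ∈ replicate j x → ∃ λ j' → j ≡ suc j' × y ≡ x
∈-replicate⁻ (suc j) (here refl)   = j , refl , refl
∈-replicate⁻ (suc j) (there y∈xs) = j , refl , proj₂ (proj₂ (∈-replicate⁻ j y∈xs))

⊆∷⇒∈⊎⊆ : ∀ {A : Set} {x : A} xs {ys} → xs ⊆ x ∷ ys → x ∈ xs ⊎ xs ⊆ ys
⊆∷⇒∈⊎⊆ []       xs⊆ = inj₂ λ ()
⊆∷⇒∈⊎⊆ (y ∷ xs) xs⊆ with xs⊆ (here refl) | ⊆∷⇒∈⊎⊆ xs (xs⊆ ∘ there)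
... | here refl  | _           = inj₁ (here refl)
... | there y∈ys | inj₁ x∈xs   = inj₁ (there x∈xs)
... | there y∈ys | inj₂ xs⊆ys = inj₂ λ { (here refl) → y∈ys ; (there z∈xs) → xs⊆ys z∈xs }

-- Renaming parameters
Renaming : Set
Renaming = Par → Par

_[_↦_] : Renaming → Par → Par → Renaming
(σ [ a ↦ e ]) b with b ≟ a
... | yes _ = e
... | no  _ = σ b

[↦]-hit : ∀ σ a e → (σ [ a ↦ e ]) a ≡ e
[↦]-hit σ a e with a ≟ a
... | yes _  = refl
... | no a≢a = ⊥-elim (a≢a refl)

[↦]-miss : ∀ σ {a} e {b} → ¬ b ≡ a → (σ [ a ↦ e ]) b ≡ σ b
[↦]-miss σ {a} e {b} b≢a with b ≟ a
... | yes b≡a = ⊥-elim (b≢a b≡a)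
... | no  _   = refl

renameTerm : Renaming → Term → Term
renameTerm σ (var y) = var y
renameTerm σ (par b) = par (σ b)

rename : Renaming → Formula → Formula
rename σ (atom p ts) = atom p (map (renameTerm σ) ts)
rename σ ⊥'          = ⊥'
rename σ (A ∧' B)    = rename σ A ∧' rename σ B
rename σ (A ∨' B)    = rename σ A ∨' rename σ B
rename σ (A ⊃ B)     = rename σ A ⊃ rename σ B
rename σ (∀' y A)    = ∀' y (rename σ A)
rename σ (∃' y A)    = ∃' y (rename σ A)

renameComponent : Renaming → Component → Component
renameComponent σ (Γ ⊢ Δ) = map (rename σ) Γ ⊢ map (rename σ) Δ

renameTerm-subst : ∀ σ a x t → renameTerm σ (substT a x t) ≡ substT (σ a) x (renameTerm σ t)
renameTerm-subst σ a x (var y) with x ≟ y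
... | yes _ = refl
... | no  _ = refl
renameTerm-subst σ a x (par b) = refl

renameTerms-subst : ∀ σ a x ts →
  map (renameTerm σ) (substTs a x ts) ≡ substTs (σ a) x (map (renameTerm σ) ts)
renameTerms-subst σ a x []       = refl
renameTerms-subst σ a x (t ∷ ts) = cong₂ _∷_ (renameTerm-subst σ a x t) (renameTerms-subst σ a x ts)

rename-subst : ∀ σ a x A → rename σ (A [ a / x ]) ≡ rename σ A [ σ a / x ]
rename-subst σ a x (atom p ts) = cong (atom p) (renameTerms-subst σ a x ts)
rename-subst σ a x ⊥'          = refl
rename-subst σ a x (A ∧' B)    = cong₂ _∧'_ (rename-subst σ a x A) (rename-subst σ a x B)
rename-subst σ a x (A ∨' B)    = cong₂ _∨'_ (rename-subst σ a x A) (rename-subst σ a x B)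
rename-subst σ a x (A ⊃ B)     = cong₂ _⊃_ (rename-subst σ a x A) (rename-subst σ a x B)
rename-subst σ a x (∀' y A) with x ≟ y
... | yes _ = refl
... | no  _ = cong (∀' y) (rename-subst σ a x A)
rename-subst σ a x (∃' y A) with x ≟ y
... | yes _ = refl
... | no  _ = cong (∃' y) (rename-subst σ a x A)

AgreeOn : (Par → Set) → Renaming → Renaming → Set
AgreeOn P σ τ = ∀ {b} → P b → σ b ≡ τ b

renameTerms-cong : ∀ {σ τ} ts → AgreeOn (λ b → Any (ParInT b) ts) σ τ →
                   map (renameTerm σ) ts ≡ map (renameTerm τ) ts
renameTerms-cong []           eq = refl
renameTerms-cong (var y ∷ ts) eq = cong (var y ∷_) (renameTerms-cong ts (eq ∘ there))
renameTerms-cong (par c ∷ ts) eq = cong₂ _∷_ (cong par (eq (here here))) (renameTerms-cong ts (eq ∘ there))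

rename-cong : ∀ {σ τ} A → AgreeOn (λ b → ParIn b A) σ τ → rename σ A ≡ rename τ A
rename-cong (atom p ts) eq = cong (atom p) (renameTerms-cong ts (eq ∘ atm))
rename-cong ⊥'          eq = refl
rename-cong (A ∧' B)    eq = cong₂ _∧'_ (rename-cong A (eq ∘ ∧ˡ)) (rename-cong B (eq ∘ ∧ʳ))
rename-cong (A ∨' B)    eq = cong₂ _∨'_ (rename-cong A (eq ∘ ∨ˡ)) (rename-cong B (eq ∘ ∨ʳ))
rename-cong (A ⊃ B)     eq = cong₂ _⊃_ (rename-cong A (eq ∘ ⊃ˡ)) (rename-cong B (eq ∘ ⊃ʳ))
rename-cong (∀' y A)    eq = cong (∀' y) (rename-cong A (eq ∘ ∀ᵇ))
rename-cong (∃' y A)    eq = cong (∃' y) (rename-cong A (eq ∘ ∃ᵇ))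

renameTerm-id : ∀ t → renameTerm id t ≡ t
renameTerm-id (var y) = refl
renameTerm-id (par c) = refl

rename-id : ∀ A → rename id A ≡ A
rename-id (atom p ts) = cong (atom p) (trans (map-cong renameTerm-id ts) (map-id ts))
rename-id ⊥'          = refl
rename-id (A ∧' B)    = cong₂ _∧'_ (rename-id A) (rename-id B)
rename-id (A ∨' B)    = cong₂ _∨'_ (rename-id A) (rename-id B)
rename-id (A ⊃ B)     = cong₂ _⊃_ (rename-id A) (rename-id B)
rename-id (∀' y A)    = cong (∀' y) (rename-id A)
rename-id (∃' y A)    = cong (∃' y) (rename-id A)

renameAll-id : ∀ Γ → map (rename id) Γ ≡ Γ
renameAll-id Γ = trans (map-cong rename-id Γ) (map-id Γ)

rename-[↦]-fresh : ∀ σ {a} e A → ¬ ParIn a A → rename (σ [ a ↦ e ]) A ≡ rename σ A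
rename-[↦]-fresh σ e A a∉A = rename-cong A (λ b∈A → [↦]-miss σ e (λ { refl → a∉A b∈A }))

renameAll-[↦]-fresh : ∀ σ {a} e Γ → ¬ Any (ParIn a) Γ → map (rename (σ [ a ↦ e ])) Γ ≡ map (rename σ) Γ
renameAll-[↦]-fresh σ e Γ a∉Γ = map-cong-local (All.map (rename-[↦]-fresh σ e _) (¬Any⇒All¬ Γ a∉Γ))

renameAll-[↦]-id : ∀ {a} e Γ → ¬ Any (ParIn a) Γ → map (rename (id [ a ↦ e ])) Γ ≡ Γ
renameAll-[↦]-id e Γ a∉Γ = trans (renameAll-[↦]-fresh id e Γ a∉Γ) (renameAll-id Γ)

rename-[↦]-eigen : ∀ σ {a} e x A → ¬ ParIn a A → rename (σ [ a ↦ e ]) (A [ a / x ]) ≡ rename σ A [ e / x ]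
rename-[↦]-eigen σ {a} e x A a∉A = begin
  rename (σ [ a ↦ e ]) (A [ a / x ])
    ≡⟨ rename-subst (σ [ a ↦ e ]) a x A ⟩
  rename (σ [ a ↦ e ]) A [ (σ [ a ↦ e ]) a / x ]
    ≡⟨ cong₂ (λ B c → B [ c / x ]) (rename-[↦]-fresh σ e A a∉A) ([↦]-hit σ a e) ⟩
  rename σ A [ e / x ]
    ∎
  where open ≡-Reasoning

rename-[↦]-id-eigen : ∀ {a} e x A → ¬ ParIn a A → rename (id [ a ↦ e ]) (A [ a / x ]) ≡ A [ e / x ]
rename-[↦]-id-eigen e x A a∉A = trans (rename-[↦]-eigen id e x A a∉A) (cong (_[ e / x ]) (rename-id A))

renameComponent-[↦]-fresh : ∀ σ {a} e c → ¬ ParInC a c →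
                            renameComponent (σ [ a ↦ e ]) c ≡ renameComponent σ c
renameComponent-[↦]-fresh σ e (Γ ⊢ Δ) a∉c =
  cong₂ _⊢_ (renameAll-[↦]-fresh σ e Γ (a∉c ∘ inj₁)) (renameAll-[↦]-fresh σ e Δ (a∉c ∘ inj₂))

renameComponent-[↦]-id : ∀ {a} e c → ¬ ParInC a c → renameComponent (id [ a ↦ e ]) c ≡ c
renameComponent-[↦]-id e (Γ ⊢ Δ) a∉c =
  cong₂ _⊢_ (renameAll-[↦]-id e Γ (a∉c ∘ inj₁)) (renameAll-[↦]-id e Δ (a∉c ∘ inj₂))

maxParTerms : List Term → ℕ
maxParTerms []           = 0
maxParTerms (var _ ∷ ts) = maxParTerms ts
maxParTerms (par b ∷ ts) = b ⊔ maxParTerms ts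

maxPar : Formula → ℕ
maxPar (atom p ts) = maxParTerms ts
maxPar ⊥'          = 0
maxPar (A ∧' B)    = maxPar A ⊔ maxPar B
maxPar (A ∨' B)    = maxPar A ⊔ maxPar B
maxPar (A ⊃ B)     = maxPar A ⊔ maxPar B
maxPar (∀' _ A)    = maxPar A
maxPar (∃' _ A)    = maxPar A

maxParAll : List Formula → ℕ
maxParAll []      = 0
maxParAll (A ∷ Γ) = maxPar A ⊔ maxParAll Γ

maxParSeq : LNS → ℕ
maxParSeq []            = 0
maxParSeq ((Γ ⊢ Δ) ∷ S) = (maxParAll Γ ⊔ maxParAll Δ) ⊔ maxParSeq S

≤-maxParTerms : ∀ {b} ts → Any (ParInT b) ts → b ≤ maxParTerms ts
≤-maxParTerms (var _ ∷ ts) (here ())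
≤-maxParTerms (var _ ∷ ts) (there b∈ts) = ≤-maxParTerms ts b∈ts
≤-maxParTerms (par b ∷ ts) (here here)  = m≤m⊔n b _
≤-maxParTerms (par c ∷ ts) (there b∈ts) = ≤-trans (≤-maxParTerms ts b∈ts) (m≤n⊔m c _)

≤-maxPar : ∀ {b} A → ParIn b A → b ≤ maxPar A
≤-maxPar (atom p ts) (atm b∈ts) = ≤-maxParTerms ts b∈ts
≤-maxPar (A ∧' B) (∧ˡ b∈A) = ≤-trans (≤-maxPar A b∈A) (m≤m⊔n _ _)
≤-maxPar (A ∧' B) (∧ʳ b∈B) = ≤-trans (≤-maxPar B b∈B) (m≤n⊔m _ _)
≤-maxPar (A ∨' B) (∨ˡ b∈A) = ≤-trans (≤-maxPar A b∈A) (m≤m⊔n _ _)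
≤-maxPar (A ∨' B) (∨ʳ b∈B) = ≤-trans (≤-maxPar B b∈B) (m≤n⊔m _ _)
≤-maxPar (A ⊃ B)  (⊃ˡ b∈A) = ≤-trans (≤-maxPar A b∈A) (m≤m⊔n _ _)
≤-maxPar (A ⊃ B)  (⊃ʳ b∈B) = ≤-trans (≤-maxPar B b∈B) (m≤n⊔m _ _)
≤-maxPar (∀' _ A) (∀ᵇ b∈A) = ≤-maxPar A b∈A
≤-maxPar (∃' _ A) (∃ᵇ b∈A) = ≤-maxPar A b∈A

≤-maxParAll : ∀ {b} Γ → Any (ParIn b) Γ → b ≤ maxParAll Γ
≤-maxParAll (A ∷ Γ) (here b∈A)  = ≤-trans (≤-maxPar A b∈A) (m≤m⊔n _ _)
≤-maxParAll (A ∷ Γ) (there b∈Γ) = ≤-trans (≤-maxParAll Γ b∈Γ) (m≤n⊔m _ _)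

≤-maxParSeq : ∀ {b} S → Any (ParInC b) S → b ≤ maxParSeq S
≤-maxParSeq ((Γ ⊢ Δ) ∷ S) (here (inj₁ b∈Γ)) =
  ≤-trans (≤-maxParAll Γ b∈Γ) (≤-trans (m≤m⊔n _ (maxParAll Δ)) (m≤m⊔n _ _))
≤-maxParSeq ((Γ ⊢ Δ) ∷ S) (here (inj₂ b∈Δ)) =
  ≤-trans (≤-maxParAll Δ b∈Δ) (≤-trans (m≤n⊔m (maxParAll Γ) _) (m≤m⊔n _ _))
≤-maxParSeq ((Γ ⊢ Δ) ∷ S) (there b∈S) = ≤-trans (≤-maxParSeq S b∈S) (m≤n⊔m _ _)

fresh : LNS → Par
fresh S = suc (maxParSeq S)

fresh-Fresh : ∀ S → Fresh (fresh S) S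
fresh-Fresh S e∈S = 1+n≰n (≤-maxParSeq S e∈S)

fresh-++ : ∀ {a} G {c H} → Fresh a (G ++ c ∷ H) → Fresh a G × ¬ ParInC a c × Fresh a H
fresh-++ G a∉S = a∉S ∘ ++⁺ˡ , a∉S ∘ ++⁺ʳ G ∘ here , a∉S ∘ ++⁺ʳ G ∘ there

fresh-↭ : ∀ {a Γ X Γ₀} → ¬ Any (ParIn a) Γ → Γ ↭ X ∷ Γ₀ → ¬ ParIn a X × ¬ Any (ParIn a) Γ₀
fresh-↭ a∉Γ Γ↭ = a∉Γ ∘ Any-resp-↭ (↭-sym Γ↭) ∘ here , a∉Γ ∘ Any-resp-↭ (↭-sym Γ↭) ∘ there

fresh-principalˡ : ∀ {a Γ Δ X Γ₀} → ¬ ParInC a (Γ ⊢ Δ) → Γ ↭ X ∷ Γ₀ →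
                   ¬ ParIn a X × ¬ ParInC a (Γ₀ ⊢ Δ)
fresh-principalˡ a∉c Γ↭ with fresh-↭ (a∉c ∘ inj₁) Γ↭
... | a∉X , a∉Γ₀ = a∉X , [ a∉Γ₀ , a∉c ∘ inj₂ ]′

fresh-principalʳ : ∀ {a Γ Δ X Δ₀} → ¬ ParInC a (Γ ⊢ Δ) → Δ ↭ X ∷ Δ₀ →
                   ¬ ParIn a X × ¬ ParInC a (Γ ⊢ Δ₀)
fresh-principalʳ a∉c Δ↭ with fresh-↭ (a∉c ∘ inj₂) Δ↭
... | a∉X , a∉Δ₀ = a∉X , [ a∉c ∘ inj₁ , a∉Δ₀ ]′

size : Formula → ℕ
size (atom _ _) = 0
size ⊥'         = 0
size (A ∧' B)   = suc (size A + size B)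
size (A ∨' B)   = suc (size A + size B)
size (A ⊃ B)    = suc (size A + size B)
size (∀' _ A)   = suc (size A)
size (∃' _ A)   = suc (size A)

size-subst : ∀ a x A → size (A [ a / x ]) ≡ size A
size-subst a x (atom p ts) = refl
size-subst a x ⊥'          = refl
size-subst a x (A ∧' B)    = cong₂ (λ m n → suc (m + n)) (size-subst a x A) (size-subst a x B)
size-subst a x (A ∨' B)    = cong₂ (λ m n → suc (m + n)) (size-subst a x A) (size-subst a x B)
size-subst a x (A ⊃ B)     = cong₂ (λ m n → suc (m + n)) (size-subst a x A) (size-subst a x B)
size-subst a x (∀' y A) with x ≟ y
... | yes _ = refl
... | no  _ = cong suc (size-subst a x A)
size-subst a x (∃' y A) with x ≟ y
... | yes _ = refl
... | no  _ = cong suc (size-subst a x A)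

data Focus (R : Component → Component → Set) (G : LNS) (c : Component) (H : LNS) : LNS → Set where
  focused : ∀ {G' c' H'} → Pointwise R G G' → R c c' → Pointwise R H H' → Focus R G c H (G' ++ c' ∷ H')

focus : ∀ {R} G {c H S'} → Pointwise R (G ++ c ∷ H) S' → Focus R G c H S'
focus []      (r ∷ rH) = focused [] r rH
focus (_ ∷ G) (r ∷ rS) with focus G rS
... | focused rG rc rH = focused (r ∷ rG) rc rH

infixr 5 _++ᴾ_

_++ᴾ_ : ∀ {R : Component → Component → Set} {G G' H H'} →
        Pointwise R G G' → Pointwise R H H' → Pointwise R (G ++ H) (G' ++ H')
_++ᴾ_ = Pointwise.++⁺

data OnLeft (R : List Formula → List Formula → Set) : Component → Component → Set where
  onLeft : ∀ {Γ Γ' Δ} → R Γ Γ' → OnLeft R (Γ ⊢ Δ) (Γ' ⊢ Δ)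

OnLeft-refl : ∀ {R} → (∀ {Γ} → R Γ Γ) → ∀ {c} → OnLeft R c c
OnLeft-refl R-refl {Γ ⊢ Δ} = onLeft R-refl

onLeftAt : ∀ {R} → (∀ {Γ} → R Γ Γ) → ∀ G H {Γ Γ' Δ} → R Γ Γ' →
           Pointwise (OnLeft R) (G ++ [ Γ ⊢ Δ ] ++ H) (G ++ [ Γ' ⊢ Δ ] ++ H)
onLeftAt R-refl G H r = Pointwise.refl (OnLeft-refl R-refl) ++ᴾ onLeft r ∷ Pointwise.refl (OnLeft-refl R-refl)

-- The height index lets `invert` recurse on premises whose eigenvariable has been renamed.
data LNIF≤ : ℕ → LNS → Set where
  id₁ : ∀ {n} G H Γ Δ p ts →
        atom p ts ∈ Γ → atom p ts ∈ Δ →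
        LNIF≤ n (G ++ [ Γ ⊢ Δ ] ++ H)
  id₂ : ∀ {n} G H F Γ₁ Δ₁ Γ₂ Δ₂ p ts →
        atom p ts ∈ Γ₁ → atom p ts ∈ Δ₂ →
        LNIF≤ n (G ++ [ Γ₁ ⊢ Δ₁ ] ++ H ++ [ Γ₂ ⊢ Δ₂ ] ++ F)
  ⊥ₗ  : ∀ {n} G H Γ Δ → ⊥' ∈ Γ → LNIF≤ n (G ++ [ Γ ⊢ Δ ] ++ H)
  ∧ₗ  : ∀ {n} G H Γ Γ₀ Δ A B → Γ ↭ (A ∧' B) ∷ Γ₀ →
        LNIF≤ n (G ++ [ A ∷ B ∷ Γ₀ ⊢ Δ ] ++ H) →
        LNIF≤ (suc n) (G ++ [ Γ ⊢ Δ ] ++ H)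
  ∨ᵣ  : ∀ {n} G H Γ Δ Δ₀ A B → Δ ↭ (A ∨' B) ∷ Δ₀ →
        LNIF≤ n (G ++ [ Γ ⊢ A ∷ B ∷ Δ₀ ] ++ H) →
        LNIF≤ (suc n) (G ++ [ Γ ⊢ Δ ] ++ H)
  ∧ᵣ  : ∀ {n} G H Γ Δ Δ₀ A B → Δ ↭ (A ∧' B) ∷ Δ₀ →
        LNIF≤ n (G ++ [ Γ ⊢ A ∷ Δ₀ ] ++ H) →
        LNIF≤ n (G ++ [ Γ ⊢ B ∷ Δ₀ ] ++ H) →
        LNIF≤ (suc n) (G ++ [ Γ ⊢ Δ ] ++ H)
  ∨ₗ  : ∀ {n} G H Γ Γ₀ Δ A B → Γ ↭ (A ∨' B) ∷ Γ₀ →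
        LNIF≤ n (G ++ [ A ∷ Γ₀ ⊢ Δ ] ++ H) →
        LNIF≤ n (G ++ [ B ∷ Γ₀ ⊢ Δ ] ++ H) →
        LNIF≤ (suc n) (G ++ [ Γ ⊢ Δ ] ++ H)
  ⊃ᵣ₁ : ∀ {n} G Γ Δ Δ₀ A B → Δ ↭ (A ⊃ B) ∷ Δ₀ →
        LNIF≤ n (G ++ [ Γ ⊢ Δ₀ ] ++ [ [ A ] ⊢ [ B ] ]) →
        LNIF≤ (suc n) (G ++ [ Γ ⊢ Δ ])
  ⊃ₗ  : ∀ {n} G H Γ Γ₀ Δ A B → Γ ↭ (A ⊃ B) ∷ Γ₀ →
        LNIF≤ n (G ++ [ B ∷ Γ₀ ⊢ Δ ] ++ H) →
        LNIF≤ n (G ++ [ Γ ⊢ A ∷ Δ ] ++ H) →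
        LNIF≤ (suc n) (G ++ [ Γ ⊢ Δ ] ++ H)
  lift : ∀ {n} G H Γ₁ Δ₁ Γ₂ Δ₂ A → A ∈ Γ₁ →
        LNIF≤ n (G ++ [ Γ₁ ⊢ Δ₁ ] ++ [ A ∷ Γ₂ ⊢ Δ₂ ] ++ H) →
        LNIF≤ (suc n) (G ++ [ Γ₁ ⊢ Δ₁ ] ++ [ Γ₂ ⊢ Δ₂ ] ++ H)
  ∀ₗ  : ∀ {n} G H Γ Δ x A (a : Par) → ∀' x A ∈ Γ →
        LNIF≤ n (G ++ [ (A [ a / x ]) ∷ Γ ⊢ Δ ] ++ H) →
        LNIF≤ (suc n) (G ++ [ Γ ⊢ Δ ] ++ H)
  ∀ᵣ₁ : ∀ {n} G Γ Δ Δ₀ x A (a : Par) → Δ ↭ ∀' x A ∷ Δ₀ →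
        Fresh a (G ++ [ Γ ⊢ Δ ]) →
        LNIF≤ n (G ++ [ Γ ⊢ Δ₀ ] ++ [ [] ⊢ [ A [ a / x ] ] ]) →
        LNIF≤ (suc n) (G ++ [ Γ ⊢ Δ ])
  ∃ₗ  : ∀ {n} G H Γ Γ₀ Δ x A (a : Par) → Γ ↭ ∃' x A ∷ Γ₀ →
        Fresh a (G ++ [ Γ ⊢ Δ ] ++ H) →
        LNIF≤ n (G ++ [ (A [ a / x ]) ∷ Γ₀ ⊢ Δ ] ++ H) →
        LNIF≤ (suc n) (G ++ [ Γ ⊢ Δ ] ++ H)
  ∃ᵣ  : ∀ {n} G H Γ Δ x A (a : Par) → ∃' x A ∈ Δ →
        LNIF≤ n (G ++ [ Γ ⊢ (A [ a / x ]) ∷ Δ ] ++ H) →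
        LNIF≤ (suc n) (G ++ [ Γ ⊢ Δ ] ++ H)
  ⊃ᵣ₂ : ∀ {n} G H Γ₁ Δ₁ Δ₁₀ Γ₂ Δ₂ A B → Δ₁ ↭ (A ⊃ B) ∷ Δ₁₀ →
        LNIF≤ n (G ++ [ Γ₁ ⊢ Δ₁₀ ] ++ [ [ A ] ⊢ [ B ] ] ++ [ Γ₂ ⊢ Δ₂ ] ++ H) →
        LNIF≤ n (G ++ [ Γ₁ ⊢ Δ₁₀ ] ++ [ Γ₂ ⊢ (A ⊃ B) ∷ Δ₂ ] ++ H) →
        LNIF≤ (suc n) (G ++ [ Γ₁ ⊢ Δ₁ ] ++ [ Γ₂ ⊢ Δ₂ ] ++ H)
  ∀ᵣ₂ : ∀ {n} G H Γ₁ Δ₁ Δ₁₀ Γ₂ Δ₂ x A (a : Par) → Δ₁ ↭ ∀' x A ∷ Δ₁₀ →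
        Fresh a (G ++ [ Γ₁ ⊢ Δ₁ ] ++ [ Γ₂ ⊢ Δ₂ ] ++ H) →
        LNIF≤ n (G ++ [ Γ₁ ⊢ Δ₁₀ ] ++ [ [] ⊢ [ A [ a / x ] ] ] ++ [ Γ₂ ⊢ Δ₂ ] ++ H) →
        LNIF≤ n (G ++ [ Γ₁ ⊢ Δ₁₀ ] ++ [ Γ₂ ⊢ ∀' x A ∷ Δ₂ ] ++ H) →
        LNIF≤ (suc n) (G ++ [ Γ₁ ⊢ Δ₁ ] ++ [ Γ₂ ⊢ Δ₂ ] ++ H)

LNIF≤-mono : ∀ {m n S} → m ≤ n → LNIF≤ m S → LNIF≤ n S
LNIF≤-mono _ (id₁ G H Γ Δ p ts m₁ m₂) = id₁ G H Γ Δ p ts m₁ m₂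
LNIF≤-mono _ (id₂ G H F Γ₁ Δ₁ Γ₂ Δ₂ p ts m₁ m₂) = id₂ G H F Γ₁ Δ₁ Γ₂ Δ₂ p ts m₁ m₂
LNIF≤-mono _ (⊥ₗ G H Γ Δ m) = ⊥ₗ G H Γ Δ m
LNIF≤-mono (s≤s m≤n) (∧ₗ G H Γ Γ₀ Δ A B p d) = ∧ₗ G H Γ Γ₀ Δ A B p (LNIF≤-mono m≤n d)
LNIF≤-mono (s≤s m≤n) (∨ᵣ G H Γ Δ Δ₀ A B p d) = ∨ᵣ G H Γ Δ Δ₀ A B p (LNIF≤-mono m≤n d)
LNIF≤-mono (s≤s m≤n) (∧ᵣ G H Γ Δ Δ₀ A B p d d') = ∧ᵣ G H Γ Δ Δ₀ A B p (LNIF≤-mono m≤n d) (LNIF≤-mono m≤n d')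
LNIF≤-mono (s≤s m≤n) (∨ₗ G H Γ Γ₀ Δ A B p d d') = ∨ₗ G H Γ Γ₀ Δ A B p (LNIF≤-mono m≤n d) (LNIF≤-mono m≤n d')
LNIF≤-mono (s≤s m≤n) (⊃ᵣ₁ G Γ Δ Δ₀ A B p d) = ⊃ᵣ₁ G Γ Δ Δ₀ A B p (LNIF≤-mono m≤n d)
LNIF≤-mono (s≤s m≤n) (⊃ₗ G H Γ Γ₀ Δ A B p d d') = ⊃ₗ G H Γ Γ₀ Δ A B p (LNIF≤-mono m≤n d) (LNIF≤-mono m≤n d')
LNIF≤-mono (s≤s m≤n) (lift G H Γ₁ Δ₁ Γ₂ Δ₂ A m d) = lift G H Γ₁ Δ₁ Γ₂ Δ₂ A m (LNIF≤-mono m≤n d)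
LNIF≤-mono (s≤s m≤n) (∀ₗ G H Γ Δ x A a m d) = ∀ₗ G H Γ Δ x A a m (LNIF≤-mono m≤n d)
LNIF≤-mono (s≤s m≤n) (∀ᵣ₁ G Γ Δ Δ₀ x A a p a∉S d) = ∀ᵣ₁ G Γ Δ Δ₀ x A a p a∉S (LNIF≤-mono m≤n d)
LNIF≤-mono (s≤s m≤n) (∃ₗ G H Γ Γ₀ Δ x A a p a∉S d) = ∃ₗ G H Γ Γ₀ Δ x A a p a∉S (LNIF≤-mono m≤n d)
LNIF≤-mono (s≤s m≤n) (∃ᵣ G H Γ Δ x A a m d) = ∃ᵣ G H Γ Δ x A a m (LNIF≤-mono m≤n d)
LNIF≤-mono (s≤s m≤n) (⊃ᵣ₂ G H Γ₁ Δ₁ Δ₁₀ Γ₂ Δ₂ A B p d d') =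
  ⊃ᵣ₂ G H Γ₁ Δ₁ Δ₁₀ Γ₂ Δ₂ A B p (LNIF≤-mono m≤n d) (LNIF≤-mono m≤n d')
LNIF≤-mono (s≤s m≤n) (∀ᵣ₂ G H Γ₁ Δ₁ Δ₁₀ Γ₂ Δ₂ x A a p a∉S d d') =
  ∀ᵣ₂ G H Γ₁ Δ₁ Δ₁₀ Γ₂ Δ₂ x A a p a∉S (LNIF≤-mono m≤n d) (LNIF≤-mono m≤n d')

byRule₁ : ∀ {S₁ S} → (∀ {n} → LNIF≤ n S₁ → LNIF≤ (suc n) S) →
        ∃ (λ n → LNIF≤ n S₁) → ∃ λ n → LNIF≤ n S
byRule₁ rule (n , d) = suc n , rule d

byRule₂ : ∀ {S₁ S₂ S} → (∀ {n} → LNIF≤ n S₁ → LNIF≤ n S₂ → LNIF≤ (suc n) S) →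
         ∃ (λ n → LNIF≤ n S₁) → ∃ (λ n → LNIF≤ n S₂) → ∃ λ n → LNIF≤ n S
byRule₂ rule (n , d) (m , d') = suc (n ⊔ m) , rule (LNIF≤-mono (m≤m⊔n n m) d) (LNIF≤-mono (m≤n⊔m n m) d')

LNIF⇒LNIF≤ : ∀ {S} → LNIF S → ∃ λ n → LNIF≤ n S
LNIF⇒LNIF≤ (id₁ G H Γ Δ p ts m₁ m₂) = 0 , id₁ G H Γ Δ p ts m₁ m₂
LNIF⇒LNIF≤ (id₂ G H F Γ₁ Δ₁ Γ₂ Δ₂ p ts m₁ m₂) = 0 , id₂ G H F Γ₁ Δ₁ Γ₂ Δ₂ p ts m₁ m₂
LNIF⇒LNIF≤ (⊥ₗ G H Γ Δ m) = 0 , ⊥ₗ G H Γ Δ m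
LNIF⇒LNIF≤ (∧ₗ G H Γ Γ₀ Δ A B p d) = byRule₁ (∧ₗ G H Γ Γ₀ Δ A B p) (LNIF⇒LNIF≤ d)
LNIF⇒LNIF≤ (∨ᵣ G H Γ Δ Δ₀ A B p d) = byRule₁ (∨ᵣ G H Γ Δ Δ₀ A B p) (LNIF⇒LNIF≤ d)
LNIF⇒LNIF≤ (∧ᵣ G H Γ Δ Δ₀ A B p d d') = byRule₂ (∧ᵣ G H Γ Δ Δ₀ A B p) (LNIF⇒LNIF≤ d) (LNIF⇒LNIF≤ d')
LNIF⇒LNIF≤ (∨ₗ G H Γ Γ₀ Δ A B p d d') = byRule₂ (∨ₗ G H Γ Γ₀ Δ A B p) (LNIF⇒LNIF≤ d) (LNIF⇒LNIF≤ d')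
LNIF⇒LNIF≤ (⊃ᵣ₁ G Γ Δ Δ₀ A B p d) = byRule₁ (⊃ᵣ₁ G Γ Δ Δ₀ A B p) (LNIF⇒LNIF≤ d)
LNIF⇒LNIF≤ (⊃ₗ G H Γ Γ₀ Δ A B p d d') = byRule₂ (⊃ₗ G H Γ Γ₀ Δ A B p) (LNIF⇒LNIF≤ d) (LNIF⇒LNIF≤ d')
LNIF⇒LNIF≤ (lift G H Γ₁ Δ₁ Γ₂ Δ₂ A m d) = byRule₁ (lift G H Γ₁ Δ₁ Γ₂ Δ₂ A m) (LNIF⇒LNIF≤ d)
LNIF⇒LNIF≤ (∀ₗ G H Γ Δ x A a m d) = byRule₁ (∀ₗ G H Γ Δ x A a m) (LNIF⇒LNIF≤ d)
LNIF⇒LNIF≤ (∀ᵣ₁ G Γ Δ Δ₀ x A a p a∉S d) = byRule₁ (∀ᵣ₁ G Γ Δ Δ₀ x A a p a∉S) (LNIF⇒LNIF≤ d)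
LNIF⇒LNIF≤ (∃ₗ G H Γ Γ₀ Δ x A a p a∉S d) = byRule₁ (∃ₗ G H Γ Γ₀ Δ x A a p a∉S) (LNIF⇒LNIF≤ d)
LNIF⇒LNIF≤ (∃ᵣ G H Γ Δ x A a m d) = byRule₁ (∃ᵣ G H Γ Δ x A a m) (LNIF⇒LNIF≤ d)
LNIF⇒LNIF≤ (⊃ᵣ₂ G H Γ₁ Δ₁ Δ₁₀ Γ₂ Δ₂ A B p d d') =
  byRule₂ (⊃ᵣ₂ G H Γ₁ Δ₁ Δ₁₀ Γ₂ Δ₂ A B p) (LNIF⇒LNIF≤ d) (LNIF⇒LNIF≤ d')
LNIF⇒LNIF≤ (∀ᵣ₂ G H Γ₁ Δ₁ Δ₁₀ Γ₂ Δ₂ x A a p a∉S d d') =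
  byRule₂ (∀ᵣ₂ G H Γ₁ Δ₁ Δ₁₀ Γ₂ Δ₂ x A a p a∉S) (LNIF⇒LNIF≤ d) (LNIF⇒LNIF≤ d')

-- Height-preserving renaming
Renames : Renaming → LNS → LNS → Set
Renames σ = Pointwise (λ c c' → renameComponent σ c ≡ c')

Renames-[↦] : ∀ {σ a S S'} e → Renames σ S S' → Fresh a S → Renames (σ [ a ↦ e ]) S S'
Renames-[↦] e []       a∉S = []
Renames-[↦] e (r ∷ rS) a∉S =
  trans (renameComponent-[↦]-fresh _ e _ (a∉S ∘ here)) r ∷ Renames-[↦] e rS (a∉S ∘ there)

Renames-id : ∀ S → Renames id S S
Renames-id []            = []
Renames-id ((Γ ⊢ Δ) ∷ S) = cong₂ _⊢_ (renameAll-id Γ) (renameAll-id Δ) ∷ Renames-id S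

LNIF≤-rename : ∀ {n S S'} σ → LNIF≤ n S → Renames σ S S' → LNIF≤ n S'
LNIF≤-rename σ (id₁ G H Γ Δ p ts m₁ m₂) r with focus G r
... | focused _ refl _ = id₁ _ _ _ _ p _ (∈-map⁺ (rename σ) m₁) (∈-map⁺ (rename σ) m₂)
LNIF≤-rename σ (id₂ G H F Γ₁ Δ₁ Γ₂ Δ₂ p ts m₁ m₂) r with focus G r
... | focused _ refl rR with focus H rR
...   | focused _ refl _ = id₂ _ _ _ _ _ _ _ p _ (∈-map⁺ (rename σ) m₁) (∈-map⁺ (rename σ) m₂)
LNIF≤-rename σ (⊥ₗ G H Γ Δ m) r with focus G r
... | focused _ refl _ = ⊥ₗ _ _ _ _ (∈-map⁺ (rename σ) m)
LNIF≤-rename σ (∧ₗ G H Γ Γ₀ Δ A B p d) r with focus G r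
... | focused rG refl rH = ∧ₗ _ _ _ _ _ _ _ (map⁺ (rename σ) p) (LNIF≤-rename σ d (rG ++ᴾ refl ∷ rH))
LNIF≤-rename σ (∨ᵣ G H Γ Δ Δ₀ A B p d) r with focus G r
... | focused rG refl rH = ∨ᵣ _ _ _ _ _ _ _ (map⁺ (rename σ) p) (LNIF≤-rename σ d (rG ++ᴾ refl ∷ rH))
LNIF≤-rename σ (∧ᵣ G H Γ Δ Δ₀ A B p d d') r with focus G r
... | focused rG refl rH = ∧ᵣ _ _ _ _ _ _ _ (map⁺ (rename σ) p)
        (LNIF≤-rename σ d (rG ++ᴾ refl ∷ rH)) (LNIF≤-rename σ d' (rG ++ᴾ refl ∷ rH))
LNIF≤-rename σ (∨ₗ G H Γ Γ₀ Δ A B p d d') r with focus G r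
... | focused rG refl rH = ∨ₗ _ _ _ _ _ _ _ (map⁺ (rename σ) p)
        (LNIF≤-rename σ d (rG ++ᴾ refl ∷ rH)) (LNIF≤-rename σ d' (rG ++ᴾ refl ∷ rH))
LNIF≤-rename σ (⊃ᵣ₁ G Γ Δ Δ₀ A B p d) r with focus G r
... | focused rG refl [] = ⊃ᵣ₁ _ _ _ _ _ _ (map⁺ (rename σ) p) (LNIF≤-rename σ d (rG ++ᴾ refl ∷ refl ∷ []))
LNIF≤-rename σ (⊃ₗ G H Γ Γ₀ Δ A B p d d') r with focus G r
... | focused rG refl rH = ⊃ₗ _ _ _ _ _ _ _ (map⁺ (rename σ) p)
        (LNIF≤-rename σ d (rG ++ᴾ refl ∷ rH)) (LNIF≤-rename σ d' (rG ++ᴾ refl ∷ rH))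
LNIF≤-rename σ (lift G H Γ₁ Δ₁ Γ₂ Δ₂ A m d) r with focus G r
... | focused rG refl (refl ∷ rH) = lift _ _ _ _ _ _ _ (∈-map⁺ (rename σ) m)
        (LNIF≤-rename σ d (rG ++ᴾ refl ∷ refl ∷ rH))
LNIF≤-rename σ (∀ₗ G H Γ Δ x A a m d) r with focus G r
... | focused rG refl rH = ∀ₗ _ _ _ _ x _ (σ a) (∈-map⁺ (rename σ) m)
        (LNIF≤-rename σ d (rG ++ᴾ cong (λ B → B ∷ _ ⊢ _) (rename-subst σ a x A) ∷ rH))
LNIF≤-rename σ (∃ᵣ G H Γ Δ x A a m d) r with focus G r
... | focused rG refl rH = ∃ᵣ _ _ _ _ x _ (σ a) (∈-map⁺ (rename σ) m)
        (LNIF≤-rename σ d (rG ++ᴾ cong (λ B → _ ⊢ B ∷ _) (rename-subst σ a x A) ∷ rH))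
LNIF≤-rename σ (⊃ᵣ₂ G H Γ₁ Δ₁ Δ₁₀ Γ₂ Δ₂ A B p d d') r with focus G r
... | focused rG refl (refl ∷ rH) = ⊃ᵣ₂ _ _ _ _ _ _ _ _ _ (map⁺ (rename σ) p)
        (LNIF≤-rename σ d (rG ++ᴾ refl ∷ refl ∷ refl ∷ rH))
        (LNIF≤-rename σ d' (rG ++ᴾ refl ∷ refl ∷ rH))
LNIF≤-rename σ (∀ᵣ₁ G Γ Δ Δ₀ x A a p a∉S d) r with focus G r
... | focused {G'} rG refl [] =
  let a∉G , a∉c , _ = fresh-++ G a∉S
      a∉∀ , a∉c₀ = fresh-principalʳ a∉c p
      e = fresh (G' ++ [ renameComponent σ (Γ ⊢ Δ) ])
  in ∀ᵣ₁ _ _ _ _ x _ e (map⁺ (rename σ) p) (fresh-Fresh _)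
       (LNIF≤-rename (σ [ a ↦ e ]) d (Renames-[↦] e rG a∉G ++ᴾ
         renameComponent-[↦]-fresh σ e _ a∉c₀
           ∷ cong (λ B → [] ⊢ [ B ]) (rename-[↦]-eigen σ e x A (a∉∀ ∘ ∀ᵇ))
           ∷ []))
LNIF≤-rename σ (∃ₗ G H Γ Γ₀ Δ x A a p a∉S d) r with focus G r
... | focused {G'} {_} {H'} rG refl rH =
  let a∉G , a∉c , a∉H = fresh-++ G a∉S
      a∉∃ , a∉c₀ = fresh-principalˡ a∉c p
      e = fresh (G' ++ [ renameComponent σ (Γ ⊢ Δ) ] ++ H')
  in ∃ₗ _ _ _ _ _ x _ e (map⁺ (rename σ) p) (fresh-Fresh _)
       (LNIF≤-rename (σ [ a ↦ e ]) d (Renames-[↦] e rG a∉G ++ᴾ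
         cong₂ _⊢_ (cong₂ _∷_ (rename-[↦]-eigen σ e x A (a∉∃ ∘ ∃ᵇ))
                              (renameAll-[↦]-fresh σ e Γ₀ (a∉c₀ ∘ inj₁)))
                   (renameAll-[↦]-fresh σ e Δ (a∉c₀ ∘ inj₂))
           ∷ Renames-[↦] e rH a∉H))
LNIF≤-rename σ (∀ᵣ₂ G H Γ₁ Δ₁ Δ₁₀ Γ₂ Δ₂ x A a p a∉S d d') r with focus G r
... | focused {G'} {_} {c₂ ∷ H'} rG refl (refl ∷ rH) =
  let a∉G , a∉c₁ , a∉S₂ = fresh-++ G a∉S
      _ , a∉c₂ , a∉H = fresh-++ [] a∉S₂
      a∉∀ , a∉c₁₀ = fresh-principalʳ a∉c₁ p
      e = fresh (G' ++ [ renameComponent σ (Γ₁ ⊢ Δ₁) ] ++ [ c₂ ] ++ H')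
  in ∀ᵣ₂ _ _ _ _ _ _ _ x _ e (map⁺ (rename σ) p) (fresh-Fresh _)
       (LNIF≤-rename (σ [ a ↦ e ]) d (Renames-[↦] e rG a∉G ++ᴾ
         renameComponent-[↦]-fresh σ e _ a∉c₁₀
           ∷ cong (λ B → [] ⊢ [ B ]) (rename-[↦]-eigen σ e x A (a∉∀ ∘ ∀ᵇ))
           ∷ renameComponent-[↦]-fresh σ e _ a∉c₂
           ∷ Renames-[↦] e rH a∉H))
       (LNIF≤-rename σ d' (rG ++ᴾ refl ∷ refl ∷ rH))

∀ᵣ₁-eigen : ∀ {n G Γ Δ Δ₀ x A a} e → Δ ↭ ∀' x A ∷ Δ₀ → Fresh a (G ++ [ Γ ⊢ Δ ]) →
            LNIF≤ n (G ++ [ Γ ⊢ Δ₀ ] ++ [ [] ⊢ [ A [ a / x ] ] ]) →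
            LNIF≤ n (G ++ [ Γ ⊢ Δ₀ ] ++ [ [] ⊢ [ A [ e / x ] ] ])
∀ᵣ₁-eigen {G = G} {x = x} {A} e p a∉S d =
  let a∉G , a∉c , _ = fresh-++ G a∉S
      a∉∀ , a∉c₀ = fresh-principalʳ a∉c p
  in LNIF≤-rename _ d (Renames-[↦] e (Renames-id G) a∉G ++ᴾ
       renameComponent-[↦]-id e _ a∉c₀
         ∷ cong (λ B → [] ⊢ [ B ]) (rename-[↦]-id-eigen e x A (a∉∀ ∘ ∀ᵇ))
         ∷ [])

∃ₗ-eigen : ∀ {n G H Γ Γ₀ Δ x A a} e → Γ ↭ ∃' x A ∷ Γ₀ → Fresh a (G ++ [ Γ ⊢ Δ ] ++ H) →
           LNIF≤ n (G ++ [ A [ a / x ] ∷ Γ₀ ⊢ Δ ] ++ H) →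
           LNIF≤ n (G ++ [ A [ e / x ] ∷ Γ₀ ⊢ Δ ] ++ H)
∃ₗ-eigen {G = G} {H} {Γ₀ = Γ₀} {Δ} {x} {A} e p a∉S d =
  let a∉G , a∉c , a∉H = fresh-++ G a∉S
      a∉∃ , a∉c₀ = fresh-principalˡ a∉c p
  in LNIF≤-rename _ d (Renames-[↦] e (Renames-id G) a∉G ++ᴾ
       cong₂ _⊢_ (cong₂ _∷_ (rename-[↦]-id-eigen e x A (a∉∃ ∘ ∃ᵇ)) (renameAll-[↦]-id e Γ₀ (a∉c₀ ∘ inj₁)))
                 (renameAll-[↦]-id e Δ (a∉c₀ ∘ inj₂))
         ∷ Renames-[↦] e (Renames-id H) a∉H)

∀ᵣ₂-eigen : ∀ {n G H Γ₁ Δ₁ Δ₁₀ Γ₂ Δ₂ x A a} e → Δ₁ ↭ ∀' x A ∷ Δ₁₀ →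
            Fresh a (G ++ [ Γ₁ ⊢ Δ₁ ] ++ [ Γ₂ ⊢ Δ₂ ] ++ H) →
            LNIF≤ n (G ++ [ Γ₁ ⊢ Δ₁₀ ] ++ [ [] ⊢ [ A [ a / x ] ] ] ++ [ Γ₂ ⊢ Δ₂ ] ++ H) →
            LNIF≤ n (G ++ [ Γ₁ ⊢ Δ₁₀ ] ++ [ [] ⊢ [ A [ e / x ] ] ] ++ [ Γ₂ ⊢ Δ₂ ] ++ H)
∀ᵣ₂-eigen {G = G} {H} {x = x} {A} e p a∉S d =
  let a∉G , a∉c₁ , a∉S₂ = fresh-++ G a∉S
      _ , a∉c₂ , a∉H = fresh-++ [] a∉S₂
      a∉∀ , a∉c₁₀ = fresh-principalʳ a∉c₁ p
  in LNIF≤-rename _ d (Renames-[↦] e (Renames-id G) a∉G ++ᴾ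
       renameComponent-[↦]-id e _ a∉c₁₀
         ∷ cong (λ B → [] ⊢ [ B ]) (rename-[↦]-id-eigen e x A (a∉∀ ∘ ∀ᵇ))
         ∷ renameComponent-[↦]-id e _ a∉c₂
         ∷ Renames-[↦] e (Renames-id H) a∉H)

-- Invertibility of the left rules
data InvertsTo : Formula → List Formula → Set where
  ∧-inv  : ∀ A B → InvertsTo (A ∧' B) (A ∷ B ∷ [])
  ∨-invˡ : ∀ A B → InvertsTo (A ∨' B) [ A ]
  ∨-invʳ : ∀ A B → InvertsTo (A ∨' B) [ B ]
  ⊃-inv  : ∀ A B → InvertsTo (A ⊃ B) [ B ]
  ∃-inv  : ∀ x A a → InvertsTo (∃' x A) [ A [ a / x ] ]

InvertsTo-smaller : ∀ {C ds} → InvertsTo C ds → All (λ D → size D < size C) ds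
InvertsTo-smaller (∧-inv A B)   = s≤s (m≤m+n _ _) ∷ s≤s (m≤n+m _ _) ∷ []
InvertsTo-smaller (∨-invˡ A B)  = s≤s (m≤m+n _ _) ∷ []
InvertsTo-smaller (∨-invʳ A B)  = s≤s (m≤n+m _ _) ∷ []
InvertsTo-smaller (⊃-inv A B)   = s≤s (m≤n+m _ _) ∷ []
InvertsTo-smaller (∃-inv x A a) = s≤s (≤-reflexive (size-subst a x A)) ∷ []

-- Several copies are needed because lift may move a copy of C into the next component.
data Inverted (C : Formula) (ds : List Formula) (Γ Γ' : List Formula) : Set where
  inverted : ∀ j Γ₀ → Γ ↭ replicate j C ++ Γ₀ → Γ' ↭ concat (replicate j ds) ++ Γ₀ →
             Inverted C ds Γ Γ'

module _ {C : Formula} {ds : List Formula} where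

  Inverted-refl : ∀ {Γ} → Inverted C ds Γ Γ
  Inverted-refl = inverted 0 _ ↭-refl ↭-refl

  Inverted-++ : ∀ X {Γ Γ'} → Inverted C ds Γ Γ' → Inverted C ds (X ++ Γ) (X ++ Γ')
  Inverted-++ X (inverted j Γ₀ Γ↭ Γ'↭) =
    inverted j (X ++ Γ₀) (↭-trans (↭-++⁺ˡ X Γ↭) (shifts X (replicate j C)))
                        (↭-trans (↭-++⁺ˡ X Γ'↭) (shifts X (concat (replicate j ds))))

  Inverted-copy : ∀ {Γ Γ'} → Inverted C ds Γ Γ' → Inverted C ds (C ∷ Γ) (ds ++ Γ')
  Inverted-copy (inverted j Γ₀ Γ↭ Γ'↭) =
    inverted (suc j) Γ₀ (↭-prep C Γ↭) (↭-trans (↭-++⁺ˡ ds Γ'↭) (↭-reflexive (sym (++-assoc ds _ Γ₀))))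

  data InvertedPrincipal (P : Formula) (Γ₁ Γ' : List Formula) : Set where
    untouched : ∀ {Γ₁'} → Γ' ↭ P ∷ Γ₁' → Inverted C ds Γ₁ Γ₁' → InvertedPrincipal P Γ₁ Γ'
    copy      : P ≡ C → Inverted C ds (ds ++ Γ₁) Γ' → InvertedPrincipal P Γ₁ Γ'

  invertedPrincipal : ∀ {P Γ Γ₁ Γ'} → Inverted C ds Γ Γ' → Γ ↭ P ∷ Γ₁ → InvertedPrincipal P Γ₁ Γ'
  invertedPrincipal {P} (inverted j Γ₀ Γ↭ Γ'↭) Γ↭P
    with ++⁻ (replicate j C) (Any-resp-↭ Γ↭ (Any-resp-↭ (↭-sym Γ↭P) (here refl)))
  ... | inj₁ P∈Cs with ∈-replicate⁻ j P∈Cs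
  ...   | j' , refl , refl = copy refl (inverted j' (ds ++ Γ₀)
          (↭-trans (↭-++⁺ˡ ds (drop-∷ (↭-trans (↭-sym Γ↭P) Γ↭))) (shifts ds (replicate j' C)))
          (↭-trans Γ'↭ (↭-trans (↭-reflexive (++-assoc ds _ Γ₀)) (shifts ds (concat (replicate j' ds))))))
  invertedPrincipal {P} (inverted j Γ₀ Γ↭ Γ'↭) Γ↭P | inj₂ P∈Γ₀ with ∈⇒↭ P∈Γ₀
  ... | Γ₀' , Γ₀↭ = untouched
          (↭-trans Γ'↭ (↭-trans (↭-++⁺ˡ _ Γ₀↭) (shift P _ Γ₀')))
          (inverted j Γ₀' (drop-∷ (↭-trans (↭-sym Γ↭P) (↭-trans Γ↭ (↭-trans (↭-++⁺ˡ _ Γ₀↭) (shift P _ Γ₀')))))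
                          ↭-refl)

  invertedMember : ∀ {X Γ Γ'} → X ∈ Γ → Inverted C ds Γ Γ' → X ∈ Γ' ⊎ (X ≡ C × ds ⊆ Γ')
  invertedMember X∈Γ (inverted j Γ₀ Γ↭ Γ'↭) with ++⁻ (replicate j C) (Any-resp-↭ Γ↭ X∈Γ)
  ... | inj₁ X∈Cs with ∈-replicate⁻ j X∈Cs
  ...   | j' , refl , X≡C = inj₂ (X≡C , Any-resp-↭ (↭-sym Γ'↭) ∘ ++⁺ˡ ∘ ++⁺ˡ)
  invertedMember X∈Γ (inverted j Γ₀ Γ↭ Γ'↭) | inj₂ X∈Γ₀ =
    inj₁ (Any-resp-↭ (↭-sym Γ'↭) (++⁺ʳ _ X∈Γ₀))

  Inverted-member : ∀ {X Γ Γ'} → InvertsTo C ds → (∀ {es} → ¬ InvertsTo X es) →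
                    X ∈ Γ → Inverted C ds Γ Γ' → X ∈ Γ'
  Inverted-member inv ¬inv X∈Γ r with invertedMember X∈Γ r
  ... | inj₁ X∈Γ'      = X∈Γ'
  ... | inj₂ (refl , _) = ⊥-elim (¬inv inv)

liftAll : ∀ {G H Γ₁ Δ₁ Γ₂ Δ₂} xs → xs ⊆ Γ₁ →
          LNIF (G ++ [ Γ₁ ⊢ Δ₁ ] ++ [ xs ++ Γ₂ ⊢ Δ₂ ] ++ H) →
          LNIF (G ++ [ Γ₁ ⊢ Δ₁ ] ++ [ Γ₂ ⊢ Δ₂ ] ++ H)
liftAll []       xs⊆Γ₁ d = d
liftAll (x ∷ xs) xs⊆Γ₁ d = liftAll xs (xs⊆Γ₁ ∘ there) (lift _ _ _ _ _ _ x (xs⊆Γ₁ (here refl)) d)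

invert : ∀ {n C ds S S'} → InvertsTo C ds → LNIF≤ n S → Pointwise (OnLeft (Inverted C ds)) S S' → LNIF S'
invert inv (id₁ G H Γ Δ p ts m₁ m₂) r with focus G r
... | focused _ (onLeft rc) _ = id₁ _ _ _ _ p ts (Inverted-member inv (λ ()) m₁ rc) m₂
invert inv (id₂ G H F Γ₁ Δ₁ Γ₂ Δ₂ p ts m₁ m₂) r with focus G r
... | focused _ (onLeft rc) rR with focus H rR
...   | focused _ (onLeft _) _ = id₂ _ _ _ _ _ _ _ p ts (Inverted-member inv (λ ()) m₁ rc) m₂
invert inv (⊥ₗ G H Γ Δ m) r with focus G r
... | focused _ (onLeft rc) _ = ⊥ₗ _ _ _ _ (Inverted-member inv (λ ()) m rc)
invert inv (∧ₗ G H Γ Γ₁ Δ A B p d) r with focus G r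
... | focused rG (onLeft rc) rH with invertedPrincipal rc p
...   | untouched Γ'↭ rc₁ = ∧ₗ _ _ _ _ Δ A B Γ'↭
        (invert inv d (rG ++ᴾ onLeft (Inverted-++ (A ∷ B ∷ []) rc₁) ∷ rH))
...   | copy refl rc₁ with inv
...     | ∧-inv _ _ = invert inv d (rG ++ᴾ onLeft rc₁ ∷ rH)
invert inv (∨ᵣ G H Γ Δ Δ₀ A B p d) r with focus G r
... | focused rG (onLeft rc) rH = ∨ᵣ _ _ _ Δ Δ₀ A B p (invert inv d (rG ++ᴾ onLeft rc ∷ rH))
invert inv (∧ᵣ G H Γ Δ Δ₀ A B p d d') r with focus G r
... | focused rG (onLeft rc) rH = ∧ᵣ _ _ _ Δ Δ₀ A B p
        (invert inv d (rG ++ᴾ onLeft rc ∷ rH)) (invert inv d' (rG ++ᴾ onLeft rc ∷ rH))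
invert inv (∨ₗ G H Γ Γ₁ Δ A B p d d') r with focus G r
... | focused rG (onLeft rc) rH with invertedPrincipal rc p
...   | untouched Γ'↭ rc₁ = ∨ₗ _ _ _ _ Δ A B Γ'↭
        (invert inv d (rG ++ᴾ onLeft (Inverted-++ [ A ] rc₁) ∷ rH))
        (invert inv d' (rG ++ᴾ onLeft (Inverted-++ [ B ] rc₁) ∷ rH))
...   | copy refl rc₁ with inv
...     | ∨-invˡ _ _ = invert inv d (rG ++ᴾ onLeft rc₁ ∷ rH)
...     | ∨-invʳ _ _ = invert inv d' (rG ++ᴾ onLeft rc₁ ∷ rH)
invert inv (⊃ᵣ₁ G Γ Δ Δ₀ A B p d) r with focus G r
... | focused rG (onLeft rc) [] = ⊃ᵣ₁ _ _ _ Δ₀ A B p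
        (invert inv d (rG ++ᴾ onLeft rc ∷ onLeft Inverted-refl ∷ []))
invert inv (⊃ₗ G H Γ Γ₁ Δ A B p d d') r with focus G r
... | focused rG (onLeft rc) rH with invertedPrincipal rc p
...   | untouched Γ'↭ rc₁ = ⊃ₗ _ _ _ _ Δ A B Γ'↭
        (invert inv d (rG ++ᴾ onLeft (Inverted-++ [ B ] rc₁) ∷ rH))
        (invert inv d' (rG ++ᴾ onLeft rc ∷ rH))
...   | copy refl rc₁ with inv
...     | ⊃-inv _ _ = invert inv d (rG ++ᴾ onLeft rc₁ ∷ rH)
invert inv (lift G H Γ₁ Δ₁ Γ₂ Δ₂ X m d) r with focus G r
... | focused rG (onLeft rc₁) (onLeft rc₂ ∷ rH) with invertedMember m rc₁
...   | inj₁ X∈Γ₁' = lift _ _ _ _ _ _ X X∈Γ₁'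
        (invert inv d (rG ++ᴾ onLeft rc₁ ∷ onLeft (Inverted-++ [ X ] rc₂) ∷ rH))
...   | inj₂ (refl , ds⊆Γ₁') = liftAll _ ds⊆Γ₁'
        (invert inv d (rG ++ᴾ onLeft rc₁ ∷ onLeft (Inverted-copy rc₂) ∷ rH))
invert inv (∀ₗ G H Γ Δ x A a m d) r with focus G r
... | focused rG (onLeft rc) rH = ∀ₗ _ _ _ Δ x A a (Inverted-member inv (λ ()) m rc)
        (invert inv d (rG ++ᴾ onLeft (Inverted-++ [ A [ a / x ] ] rc) ∷ rH))
invert inv (∃ᵣ G H Γ Δ x A a m d) r with focus G r
... | focused rG (onLeft rc) rH = ∃ᵣ _ _ _ Δ x A a m (invert inv d (rG ++ᴾ onLeft rc ∷ rH))
invert inv (∀ᵣ₁ G Γ Δ Δ₀ x A a p a∉S d) r with focus G r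
... | focused {G'} rG (onLeft {Γ' = Γ'} rc) [] =
  let e = fresh (G' ++ [ Γ' ⊢ Δ ])
  in ∀ᵣ₁ G' Γ' Δ Δ₀ x A e p (fresh-Fresh _)
       (invert inv (∀ᵣ₁-eigen e p a∉S d) (rG ++ᴾ onLeft rc ∷ onLeft Inverted-refl ∷ []))
invert inv (∃ₗ G H Γ Γ₁ Δ x A a p a∉S d) r with focus G r
... | focused {G'} {_} {H'} rG (onLeft {Γ' = Γ'} rc) rH with invertedPrincipal rc p
...   | untouched Γ'↭ rc₁ =
  let e = fresh (G' ++ [ Γ' ⊢ Δ ] ++ H')
  in ∃ₗ G' H' Γ' _ Δ x A e Γ'↭ (fresh-Fresh _)
       (invert inv (∃ₗ-eigen e p a∉S d) (rG ++ᴾ onLeft (Inverted-++ [ A [ e / x ] ] rc₁) ∷ rH))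
...   | copy refl rc₁ with inv
...     | ∃-inv _ _ b = invert inv (∃ₗ-eigen b p a∉S d) (rG ++ᴾ onLeft rc₁ ∷ rH)
invert inv (⊃ᵣ₂ G H Γ₁ Δ₁ Δ₁₀ Γ₂ Δ₂ A B p d d') r with focus G r
... | focused rG (onLeft rc₁) (onLeft rc₂ ∷ rH) = ⊃ᵣ₂ _ _ _ _ Δ₁₀ _ _ A B p
        (invert inv d (rG ++ᴾ onLeft rc₁ ∷ onLeft Inverted-refl ∷ onLeft rc₂ ∷ rH))
        (invert inv d' (rG ++ᴾ onLeft rc₁ ∷ onLeft rc₂ ∷ rH))
invert inv (∀ᵣ₂ G H Γ₁ Δ₁ Δ₁₀ Γ₂ Δ₂ x A a p a∉S d d') r with focus G r
... | focused {G'} {_} {_ ∷ H'} rG (onLeft {Γ' = Γ₁'} rc₁) (onLeft {Γ' = Γ₂'} rc₂ ∷ rH) =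
  let e = fresh (G' ++ [ Γ₁' ⊢ Δ₁ ] ++ [ Γ₂' ⊢ Δ₂ ] ++ H')
  in ∀ᵣ₂ G' H' Γ₁' Δ₁ Δ₁₀ Γ₂' Δ₂ x A e p (fresh-Fresh _)
       (invert inv (∀ᵣ₂-eigen e p a∉S d) (rG ++ᴾ onLeft rc₁ ∷ onLeft Inverted-refl ∷ onLeft rc₂ ∷ rH))
       (invert inv d' (rG ++ᴾ onLeft rc₁ ∷ onLeft rc₂ ∷ rH))

invertLeft : ∀ {C ds} G H {Γ Γ₁ Δ} → InvertsTo C ds → Γ ↭ C ∷ Γ₁ →
             LNIF (G ++ [ Γ ⊢ Δ ] ++ H) → LNIF (G ++ [ ds ++ Γ₁ ⊢ Δ ] ++ H)
invertLeft {ds = ds} G H {Γ₁ = Γ₁} inv Γ↭ d =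
  invert inv (proj₂ (LNIF⇒LNIF≤ d))
    (onLeftAt Inverted-refl G H (inverted 1 Γ₁ Γ↭ (↭-reflexive (sym (++-assoc ds [] Γ₁)))))

-- Contraction
data Contracted (b : ℕ) (Γ Γ' : List Formula) : Set where
  contracted : ∀ Fs → Γ ↭ Fs ++ Γ' → All (λ F → size F < b) Fs → Fs ⊆ Γ' → Contracted b Γ Γ'

Contraction : ℕ → Set
Contraction b = ∀ {S S'} → LNIF S → Pointwise (OnLeft (Contracted b)) S S' → LNIF S'

module _ {b : ℕ} where

  Contracted-refl : ∀ {Γ} → Contracted b Γ Γ
  Contracted-refl = contracted [] ↭-refl [] (λ ())

  Contracted-++ : ∀ X {Γ Γ'} → Contracted b Γ Γ' → Contracted b (X ++ Γ) (X ++ Γ')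
  Contracted-++ X (contracted Fs Γ↭ small kept) =
    contracted Fs (↭-trans (↭-++⁺ˡ X Γ↭) (shifts X Fs)) small (++⁺ʳ X ∘ kept)

  Contracted-member : ∀ {X Γ Γ'} → X ∈ Γ → Contracted b Γ Γ' → X ∈ Γ'
  Contracted-member X∈Γ (contracted Fs Γ↭ small kept) with ++⁻ Fs (Any-resp-↭ Γ↭ X∈Γ)
  ... | inj₁ X∈Fs = kept X∈Fs
  ... | inj₂ X∈Γ' = X∈Γ'

  Contracted-fresh : ∀ {a S S'} → Fresh a S → Pointwise (OnLeft (Contracted b)) S S' → Fresh a S'
  Contracted-fresh a∉S (onLeft (contracted Fs Γ↭ _ _) ∷ _) (here (inj₁ a∈Γ')) =
    a∉S (here (inj₁ (Any-resp-↭ (↭-sym Γ↭) (++⁺ʳ Fs a∈Γ'))))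
  Contracted-fresh a∉S (onLeft _ ∷ _) (here (inj₂ a∈Δ)) = a∉S (here (inj₂ a∈Δ))
  Contracted-fresh a∉S (_ ∷ r) (there a∈S') = Contracted-fresh (a∉S ∘ there) r a∈S'

  data ContractedPrincipal (P : Formula) (Γ₁ Γ' : List Formula) : Set where
    untouched : ∀ {Γ₁'} → Γ' ↭ P ∷ Γ₁' → Contracted b Γ₁ Γ₁' → ContractedPrincipal P Γ₁ Γ'
    deleted   : ∀ {Γ₁'} → Γ' ↭ P ∷ Γ₁' → Contracted b Γ₁ Γ' → size P < b →
                ContractedPrincipal P Γ₁ Γ'

  deletedPrincipal : ∀ {P Γ Γ₁ Γ' Fs} → Γ ↭ P ∷ Γ₁ →
                     Γ ↭ Fs ++ Γ' → All (λ F → size F < b) Fs → Fs ⊆ Γ' → P ∈ Fs →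
                     ContractedPrincipal P Γ₁ Γ'
  deletedPrincipal {Γ' = Γ'} Γ↭P Γ↭ small kept P∈Fs with ∈⇒↭ P∈Fs | ∈⇒↭ (kept P∈Fs)
  ... | Fs' , Fs↭ | _ , Γ'↭ = deleted Γ'↭
        (contracted Fs' (drop-∷ (↭-trans (↭-sym Γ↭P) (↭-trans Γ↭ (↭-++⁺ʳ Γ' Fs↭))))
          (All.tail (All-resp-↭ Fs↭ small)) (kept ∘ Any-resp-↭ (↭-sym Fs↭) ∘ there))
        (All.lookup small P∈Fs)

  contractedPrincipal : ∀ {P Γ Γ₁ Γ'} → Contracted b Γ Γ' → Γ ↭ P ∷ Γ₁ →
                        ContractedPrincipal P Γ₁ Γ'
  contractedPrincipal {P} (contracted Fs Γ↭ small kept) Γ↭P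
    with ++⁻ Fs (Any-resp-↭ Γ↭ (Any-resp-↭ (↭-sym Γ↭P) (here refl)))
  ... | inj₁ P∈Fs = deletedPrincipal Γ↭P Γ↭ small kept P∈Fs
  ... | inj₂ P∈Γ' with ∈⇒↭ P∈Γ'
  ...   | Γ₁' , Γ'↭ with ⊆∷⇒∈⊎⊆ Fs (Any-resp-↭ Γ'↭ ∘ kept)
  ...     | inj₁ P∈Fs   = deletedPrincipal Γ↭P Γ↭ small kept P∈Fs
  ...     | inj₂ Fs⊆Γ₁' = untouched Γ'↭
            (contracted Fs (drop-∷ (↭-trans (↭-sym Γ↭P) (↭-trans Γ↭ (↭-trans (↭-++⁺ˡ Fs Γ'↭) (shift P Fs Γ₁')))))
                        small Fs⊆Γ₁')

module _ (b : ℕ) (ih : ∀ {b'} → b' < b → Contraction b') where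

  contractInverted : ∀ {C ds G H Γ Γ₁ Δ} → InvertsTo C ds → size C < b → Γ ↭ C ∷ Γ₁ →
                     LNIF (G ++ [ ds ++ Γ ⊢ Δ ] ++ H) → LNIF (G ++ [ ds ++ Γ₁ ⊢ Δ ] ++ H)
  contractInverted {C} {ds} {G} {H} {Γ₁ = Γ₁} inv C<b Γ↭ d =
    ih C<b (invertLeft G H inv (↭-trans (↭-++⁺ˡ ds Γ↭) (shift C ds Γ₁)) d)
      (onLeftAt Contracted-refl G H (contracted ds ↭-refl (InvertsTo-smaller inv) ++⁺ˡ))

  contract : Contraction b
  contract (id₁ G H Γ Δ p ts m₁ m₂) r with focus G r
  ... | focused _ (onLeft rc) _ = id₁ _ _ _ _ p ts (Contracted-member m₁ rc) m₂
  contract (id₂ G H F Γ₁ Δ₁ Γ₂ Δ₂ p ts m₁ m₂) r with focus G r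
  ... | focused _ (onLeft rc) rR with focus H rR
  ...   | focused _ (onLeft _) _ = id₂ _ _ _ _ _ _ _ p ts (Contracted-member m₁ rc) m₂
  contract (⊥ₗ G H Γ Δ m) r with focus G r
  ... | focused _ (onLeft rc) _ = ⊥ₗ _ _ _ _ (Contracted-member m rc)
  contract (∧ₗ G H Γ Γ₁ Δ A B p d) r with focus G r
  ... | focused rG (onLeft rc) rH with contractedPrincipal rc p
  ...   | untouched Γ'↭ rc₁ = ∧ₗ _ _ _ _ Δ A B Γ'↭
          (contract d (rG ++ᴾ onLeft (Contracted-++ (A ∷ B ∷ []) rc₁) ∷ rH))
  ...   | deleted Γ'↭ rc₁ P<b = ∧ₗ _ _ _ _ Δ A B Γ'↭ (contractInverted (∧-inv A B) P<b Γ'↭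
          (contract d (rG ++ᴾ onLeft (Contracted-++ (A ∷ B ∷ []) rc₁) ∷ rH)))
  contract (∨ᵣ G H Γ Δ Δ₀ A B p d) r with focus G r
  ... | focused rG (onLeft rc) rH = ∨ᵣ _ _ _ Δ Δ₀ A B p (contract d (rG ++ᴾ onLeft rc ∷ rH))
  contract (∧ᵣ G H Γ Δ Δ₀ A B p d d') r with focus G r
  ... | focused rG (onLeft rc) rH = ∧ᵣ _ _ _ Δ Δ₀ A B p
          (contract d (rG ++ᴾ onLeft rc ∷ rH)) (contract d' (rG ++ᴾ onLeft rc ∷ rH))
  contract (∨ₗ G H Γ Γ₁ Δ A B p d d') r with focus G r
  ... | focused rG (onLeft rc) rH with contractedPrincipal rc p
  ...   | untouched Γ'↭ rc₁ = ∨ₗ _ _ _ _ Δ A B Γ'↭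
          (contract d (rG ++ᴾ onLeft (Contracted-++ [ A ] rc₁) ∷ rH))
          (contract d' (rG ++ᴾ onLeft (Contracted-++ [ B ] rc₁) ∷ rH))
  ...   | deleted Γ'↭ rc₁ P<b = ∨ₗ _ _ _ _ Δ A B Γ'↭
          (contractInverted (∨-invˡ A B) P<b Γ'↭ (contract d (rG ++ᴾ onLeft (Contracted-++ [ A ] rc₁) ∷ rH)))
          (contractInverted (∨-invʳ A B) P<b Γ'↭ (contract d' (rG ++ᴾ onLeft (Contracted-++ [ B ] rc₁) ∷ rH)))
  contract (⊃ᵣ₁ G Γ Δ Δ₀ A B p d) r with focus G r
  ... | focused rG (onLeft rc) [] = ⊃ᵣ₁ _ _ _ Δ₀ A B p
          (contract d (rG ++ᴾ onLeft rc ∷ onLeft Contracted-refl ∷ []))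
  contract (⊃ₗ G H Γ Γ₁ Δ A B p d d') r with focus G r
  ... | focused rG (onLeft rc) rH with contractedPrincipal rc p
  ...   | untouched Γ'↭ rc₁ = ⊃ₗ _ _ _ _ Δ A B Γ'↭
          (contract d (rG ++ᴾ onLeft (Contracted-++ [ B ] rc₁) ∷ rH))
          (contract d' (rG ++ᴾ onLeft rc ∷ rH))
  ...   | deleted Γ'↭ rc₁ P<b = ⊃ₗ _ _ _ _ Δ A B Γ'↭
          (contractInverted (⊃-inv A B) P<b Γ'↭ (contract d (rG ++ᴾ onLeft (Contracted-++ [ B ] rc₁) ∷ rH)))
          (contract d' (rG ++ᴾ onLeft rc ∷ rH))
  contract (lift G H Γ₁ Δ₁ Γ₂ Δ₂ X m d) r with focus G r
  ... | focused rG (onLeft rc₁) (onLeft rc₂ ∷ rH) = lift _ _ _ _ _ _ X (Contracted-member m rc₁)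
          (contract d (rG ++ᴾ onLeft rc₁ ∷ onLeft (Contracted-++ [ X ] rc₂) ∷ rH))
  contract (∀ₗ G H Γ Δ x A a m d) r with focus G r
  ... | focused rG (onLeft rc) rH = ∀ₗ _ _ _ Δ x A a (Contracted-member m rc)
          (contract d (rG ++ᴾ onLeft (Contracted-++ [ A [ a / x ] ] rc) ∷ rH))
  contract (∃ᵣ G H Γ Δ x A a m d) r with focus G r
  ... | focused rG (onLeft rc) rH = ∃ᵣ _ _ _ Δ x A a m (contract d (rG ++ᴾ onLeft rc ∷ rH))
  contract (∀ᵣ₁ G Γ Δ Δ₀ x A a p a∉S d) r with focus G r
  ... | focused rG (onLeft rc) [] = ∀ᵣ₁ _ _ _ Δ₀ x A a p (Contracted-fresh a∉S (rG ++ᴾ onLeft rc ∷ []))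
          (contract d (rG ++ᴾ onLeft rc ∷ onLeft Contracted-refl ∷ []))
  contract (∃ₗ G H Γ Γ₁ Δ x A a p a∉S d) r with focus G r
  ... | focused rG (onLeft rc) rH with contractedPrincipal rc p
  ...   | untouched Γ'↭ rc₁ = ∃ₗ _ _ _ _ Δ x A a Γ'↭ (Contracted-fresh a∉S (rG ++ᴾ onLeft rc ∷ rH))
          (contract d (rG ++ᴾ onLeft (Contracted-++ [ A [ a / x ] ] rc₁) ∷ rH))
  ...   | deleted Γ'↭ rc₁ P<b = ∃ₗ _ _ _ _ Δ x A a Γ'↭ (Contracted-fresh a∉S (rG ++ᴾ onLeft rc ∷ rH))
          (contractInverted (∃-inv x A a) P<b Γ'↭
            (contract d (rG ++ᴾ onLeft (Contracted-++ [ A [ a / x ] ] rc₁) ∷ rH)))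
  contract (⊃ᵣ₂ G H Γ₁ Δ₁ Δ₁₀ Γ₂ Δ₂ A B p d d') r with focus G r
  ... | focused rG (onLeft rc₁) (onLeft rc₂ ∷ rH) = ⊃ᵣ₂ _ _ _ _ Δ₁₀ _ _ A B p
          (contract d (rG ++ᴾ onLeft rc₁ ∷ onLeft Contracted-refl ∷ onLeft rc₂ ∷ rH))
          (contract d' (rG ++ᴾ onLeft rc₁ ∷ onLeft rc₂ ∷ rH))
  contract (∀ᵣ₂ G H Γ₁ Δ₁ Δ₁₀ Γ₂ Δ₂ x A a p a∉S d d') r with focus G r
  ... | focused rG (onLeft rc₁) (onLeft rc₂ ∷ rH) = ∀ᵣ₂ _ _ _ _ Δ₁₀ _ _ x A a p
          (Contracted-fresh a∉S (rG ++ᴾ onLeft rc₁ ∷ onLeft rc₂ ∷ rH))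
          (contract d (rG ++ᴾ onLeft rc₁ ∷ onLeft Contracted-refl ∷ onLeft rc₂ ∷ rH))
          (contract d' (rG ++ᴾ onLeft rc₁ ∷ onLeft rc₂ ∷ rH))

contraction : ∀ b → Contraction b
contraction = <-rec Contraction contract

lemma14 : ∀ (G H : LNS) (Γ Δ : List Formula) (A : Formula) →
          ClosedS (G ++ [ A ∷ A ∷ Γ ⊢ Δ ] ++ H) →
          LNIF (G ++ [ A ∷ A ∷ Γ ⊢ Δ ] ++ H) →
          LNIF (G ++ [ A ∷ Γ ⊢ Δ ] ++ H)
lemma14 G H Γ Δ A _ d = contraction (suc (size A)) d (onLeftAt Contracted-refl G H dropCopy)
  where
  dropCopy : Contracted (suc (size A)) (A ∷ A ∷ Γ) (A ∷ Γ)
  dropCopy = contracted [ A ] ↭-refl (≤-refl ∷ []) λ { (here refl) → here refl }
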